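{- Fix positive integers $r,s$ and define $$g_{r,s}(x,y,z)=sx^2-ry^2+(r-2)sx+rsy-2rsz.$$ Then $g_{r,s}$ is invariant under $f_{r,s}$ on $\mathbf{Rec}$: for every integer triple $(x,y,z)$ with $x\le 0$, $y\ge 0$, $x\le z\le y$, we have $g_{r,s}(f_{r,s}(x,y,z))=g_{r,s}(x,y,z)$.
   Context: Here $f_{r,s}$ denotes the one-dimensional generalized rotor-router map restricted to the recurrent states $\mathbf{Rec}$, which are identified with integer triples $(x,y,z)$, $x\le0\le y$, $x\le z\le y$ (the state with occupied interval $[x,y+s-1]$, labels $R$ on $[x,z-1]$, $L$ on $[z,y-1]$, $R$ on $[y,y+s-1]$). On these triples $f_{r,s}$ is given by $f_{r,s}(x,y,z)=(x,y+s,z-y)$ if $x+y\le z$ and $f_{r,s}(x,y,z)=(x-r,y,z-x+1)$ if $x+y>z$. (The underlying dynamics: a particle starts at $0$, at each occupied site moves left on label $L$ and right on label $R$ and flips that label, and on first reaching an unoccupied site on the left (resp. right) $r$ (resp. $s$) new sites labeled $R$ are added on that side.) -}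

module Defs where

open import Data.Integer using (ℤ; +_; _+_; _-_; _*_; -_; _≤_; _≤?_)
open import Data.Product using (_×_; _,_)
open import Relation.Nullary using (yes; no)

Triple : Set
Triple = ℤ × ℤ × ℤ

-- The generalized rotor-router map f_{r,s} restricted to Rec:
--   f(x,y,z) = (x, y+s, z-y)     if x + y ≤ z
--   f(x,y,z) = (x-r, y, z-x+1)   if x + y > z
f : ℤ → ℤ → Triple → Triple
f r s (x , y , z) with (x + y) ≤? z
... | yes _ = (x , y + s , z - y)
... | no  _ = (x - r , y , (z - x) + + 1)

g : ℤ → ℤ → Triple → ℤ
g r s (x , y , z) =
  s * (x * x) - r * (y * y) + (r - + 2) * s * x + r * s * y - + 2 * r * s * z

-- Each of the two branches of f preserves g as a polynomial identity in r, s, x, y, z,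
-- so neither the case condition nor the inequalities defining Rec are needed.
module Submission where

open import Defs
open import Data.Integer using (ℤ; +_; _<_; _≤_; _≤?_; _+_; _-_; _*_)
open import Data.Product using (_,_)
open import Relation.Binary.PropositionalEquality using (_≡_)
open import Relation.Nullary using (yes; no)
open import Data.Integer.Tactic.RingSolver using (solve-∀)

-- The ring solver cannot see through g, so each step is first stated with g unfolded.
g-invariant-right-step : ∀ r s x y z → g r s (x , y + s , z - y) ≡ g r s (x , y , z)
g-invariant-right-step r s x y z = identity r s x y z
  where
  identity : ∀ r s x y z →
    s * (x * x) - r * ((y + s) * (y + s)) + (r - + 2) * s * x + r * s * (y + s) - + 2 * r * s * (z - y)
      ≡ s * (x * x) - r * (y * y) + (r - + 2) * s * x + r * s * y - + 2 * r * s * z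
  identity = solve-∀

g-invariant-left-step : ∀ r s x y z → g r s (x - r , y , (z - x) + + 1) ≡ g r s (x , y , z)
g-invariant-left-step r s x y z = identity r s x y z
  where
  identity : ∀ r s x y z →
    s * ((x - r) * (x - r)) - r * (y * y) + (r - + 2) * s * (x - r) + r * s * y - + 2 * r * s * ((z - x) + + 1)
      ≡ s * (x * x) - r * (y * y) + (r - + 2) * s * x + r * s * y - + 2 * r * s * z
  identity = solve-∀

g∘f≡g : ∀ r s x y z → g r s (f r s (x , y , z)) ≡ g r s (x , y , z)
g∘f≡g r s x y z with (x + y) ≤? z
... | yes _ = g-invariant-right-step r s x y z
... | no  _ = g-invariant-left-step r s x y z

lemma2p6 : (r s : ℤ) → + 0 < r → + 0 < s →
    (x y z : ℤ) → x ≤ + 0 → + 0 ≤ y → x ≤ z → z ≤ y →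
    g r s (f r s (x , y , z)) ≡ g r s (x , y , z)
lemma2p6 r s _ _ x y z _ _ _ _ = g∘f≡g r s x y z
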